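{- Let $k\ge 1$. Let $\mathcal{H}$ be the bi-hypergraph obtained from $\mathcal{H}_{2k+1}$ by adding a new vertex $v$, removing the edge $\{v_{1,1},v_{1,2},v_{1,3}\}$, and adding the edges $\{v,v_{2k+1,i},v_{2k+1,i+1}\}$ for $i\in\{1,2\}$ and the edges $\{v,v_{1,j},v_{2k+1,j}\}$ for $j\in\{1,2,3\}$. Then $\mathcal{H}$ is minimal uncolorable.
   Context: A bi-hypergraph is a pair $(\mathcal{V},\mathcal{E})$ with $\mathcal{V}$ a finite set and $\mathcal{E}$ a family of subsets of $\mathcal{V}$ (edges). A proper coloring is a map $f:\mathcal{V}\to\mathbb{N}$ with $1<|\{f(x):x\in e\}|<|e|$ for every edge $e$; a bi-hypergraph is colorable if such $f$ exists. A subhypergraph is $(\mathcal{V}',\mathcal{E}')$ with $\mathcal{V}'\subseteq\mathcal{V}$, $\mathcal{E}'\subseteq\mathcal{E}$; a bi-hypergraph is minimal uncolorable if it is uncolorable but each of its proper subhypergraphs is colorable. For $k\ge 2$, let $V_i=\{v_{i,1},v_{i,2},v_{i,3}\}$ ($i\in[k]$) be pairwise disjoint sets, and write $v_{i,4}=v_{i,1}$, $v_{i,5}=v_{i,2}$. The bi-hypergraph $\mathcal{H}_k$ has vertex set $V_1\cup\cdots\cup V_k$ and edge set consisting of the edges $V_i$ for all $i\in[k]$, together with the edges $\{v_{q+1,j},v_{q,j},v_{q,j+t}\}$ for all $q\in[k-1]$, $j\in\{1,2,3\}$, $t\in\{1,2\}$. -}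

module Defs where

open import Data.Nat using (ℕ; zero; suc; _+_; _*_; _<_)
open import Data.Fin using (Fin; zero; suc; inject₁; fromℕ; combine)
open import Data.Fin.Subset using (Subset; _∈_; _⊆_; _∪_; ⁅_⁆; ∣_∣; ⊤)
open import Data.Fin.Subset.Properties using (_∈?_)
open import Data.List using (List; []; _∷_; _++_; map; concatMap; filter; length; deduplicate; lookup; allFin)
open import Data.Product using (Σ; _×_; _,_)
open import Relation.Nullary using (¬_)
open import Relation.Binary.PropositionalEquality using (_≡_)
import Data.Nat.Properties as ℕP

-- A bi-hypergraph on the finite vertex set Fin n, with edge family
-- given as a list of subsets of Fin n (the edges of the concrete
-- hypergraph below are pairwise distinct, so the list is a family).

record BiHypergraph : Set where
  field
    n     : ℕ
    edges : List (Subset n)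

  edge : Fin (length edges) → Subset n
  edge i = lookup edges i

open BiHypergraph public

members : ∀ {n} → Subset n → List (Fin n)
members p = filter (λ x → x ∈? p) (allFin _)

numColors : ∀ {n} → (Fin n → ℕ) → Subset n → ℕ
numColors f e = length (deduplicate ℕP._≟_ (map f (members e)))

ProperOn : ∀ {n} → (Fin n → ℕ) → Subset n → Set
ProperOn f e = (1 < numColors f e) × (numColors f e < ∣ e ∣)

record SubHypergraph (H : BiHypergraph) : Set where
  field
    V′      : Subset (n H)
    E′      : Subset (length (edges H))
    edgesIn : ∀ i → i ∈ E′ → edge H i ⊆ V′

open SubHypergraph public

IsProper : {H : BiHypergraph} → SubHypergraph H → Set
IsProper S = ¬ ((V′ S ≡ ⊤) × (E′ S ≡ ⊤))

-- a subhypergraph is colorable: there is a coloring of its vertices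
-- that is proper on each of its edges (values outside V′ are irrelevant)
SubColorable : {H : BiHypergraph} → SubHypergraph H → Set
SubColorable {H} S =
  Σ (Fin (n H) → ℕ) λ f → ∀ i → i ∈ E′ S → ProperOn f (edge H i)

Colorable : BiHypergraph → Set
Colorable H = Σ (Fin (n H) → ℕ) λ f → ∀ i → ProperOn f (edge H i)

MinimalUncolorable : BiHypergraph → Set
MinimalUncolorable H =
  (¬ Colorable H) × (∀ (S : SubHypergraph H) → IsProper S → SubColorable S)

-- m = 2k+1 layers V_1 .. V_m (layer i ↦ Fin m, index i-1), positions
-- j ∈ {1,2,3} ↦ Fin 3.  Vertex set Fin (1 + m * 3): zero is the new
-- vertex v, and v_{i,j} = suc (combine (i-1) (j-1)).

triple : ∀ {n} → Fin n → Fin n → Fin n → Subset n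
triple a b c = ⁅ a ⁆ ∪ (⁅ b ⁆ ∪ ⁅ c ⁆)

next3 : Fin 3 → Fin 3
next3 zero = suc zero
next3 (suc zero) = suc (suc zero)
next3 (suc (suc zero)) = zero

module HDef (k : ℕ) where
  m : ℕ
  m = suc (2 * k)

  N : ℕ
  N = suc (m * 3)

  vv : Fin N
  vv = zero

  -- vx i j = v_{i+1, j+1}
  vx : Fin m → Fin 3 → Fin N
  vx i j = suc (combine i j)

  lastL : Fin m
  lastL = fromℕ (2 * k)

  -- edges V_i for i = 2, ..., 2k+1
  layerEdges : List (Subset N)
  layerEdges = map (λ (i : Fin (2 * k)) →
                      triple (vx (suc i) zero) (vx (suc i) (suc zero)) (vx (suc i) (suc (suc zero))))
                   (allFin _)

  -- edges {v_{q+1,j}, v_{q,j}, v_{q,j+t}}, q ∈ [2k], j ∈ {1,2,3}, t ∈ {1,2}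
  linkEdges : List (Subset N)
  linkEdges =
    concatMap (λ (q : Fin (2 * k)) →
      concatMap (λ (j : Fin 3) →
          triple (vx (suc q) j) (vx (inject₁ q) j) (vx (inject₁ q) (next3 j))
        ∷ triple (vx (suc q) j) (vx (inject₁ q) j) (vx (inject₁ q) (next3 (next3 j)))
        ∷ [])
        (allFin 3))
      (allFin _)

  topEdges : List (Subset N)
  topEdges =
      triple vv (vx lastL zero) (vx lastL (suc zero))
    ∷ triple vv (vx lastL (suc zero)) (vx lastL (suc (suc zero)))
    ∷ []

  crossEdges : List (Subset N)
  crossEdges = map (λ (j : Fin 3) → triple vv (vx zero j) (vx lastL j)) (allFin 3)

  H : BiHypergraph
  H = record { n = N ; edges = layerEdges ++ linkEdges ++ topEdges ++ crossEdges }

Hlemma : ℕ → BiHypergraph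
Hlemma k = HDef.H k

-- Every edge has three distinct vertices, so a colouring is proper on it iff it uses
-- exactly two colours there.  Read each layer V_i as a colour triple.  The six edges
-- between V_i and V_{i+1} force: if V_i carries b at one position and a at the other
-- two, then the two-coloured layer V_{i+1} carries a at that position and b at the
-- others.  Hence a two-coloured V_1 reappears unchanged in V_{2k+1}; a monochromatic
-- V_1 of colour a forces V_2 to avoid a, and V_2 reappears in V_{2k+1} with its two
-- colours swapped; a three-coloured V_1 is copied onto V_2, which is impossible.  In
-- the first two cases the top and cross edges through v cannot all be two-coloured.
-- Minimality only needs, for each edge, a colouring proper on all the others; these
-- alternate two colour triples along the layers and switch at the removed edge.

module Submission where

open import Defs
open import Data.Empty using (⊥; ⊥-elim)
open import Data.Fin using (Fin; zero; suc; inject₁; toℕ; fromℕ; cast; combine; remQuot)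
open import Data.Fin.Induction using (<-weakInduction)
open import Data.Fin.Properties
  using (suc-injective; toℕ-injective; toℕ-inject₁; toℕ-fromℕ; toℕ<n; toℕ-cast;
         combine-injective; combine-remQuot; remQuot-combine; all?; any?)
import Data.Fin.Properties as Fin
open import Data.Fin.Subset using (Subset; inside; outside; ⁅_⁆; _∪_; ∣_∣; ⊤)
  renaming (_∈_ to _∈ˢ_; _∉_ to _∉ˢ_)
open import Data.Fin.Subset.Properties
  using (_∈?_; x∈p∪q⁻; x∈p∪q⁺; x∈⁅x⁆; x∈⁅y⁆⇒x≡y; x≢y⇒x∉⁅y⁆; ∣⁅x⁆∣≡1; ∪-identityˡ;
         ⊆-antisym; ⊆-max)
open import Data.List using (List; []; _∷_; _++_; map; concatMap; length; lookup; deduplicate; allFin)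
open import Data.List.Properties using (length-map; map-concatMap; map-∘; ++-identityʳ)
open import Data.List.Membership.Propositional using (_∈_; find; lose)
open import Data.List.Membership.Propositional.Properties
  using (∈-filter⁺; ∈-filter⁻; ∈-allFin; ∈-map⁺; ∈-concatMap⁺; ∈-concatMap⁻; ∈-lookup;
         ∈-deduplicate⁺; ∈-deduplicate⁻)
open import Data.List.Membership.Propositional.Properties.WithK using (unique∧set⇒bag)
open import Data.List.Relation.Binary.BagAndSetEquality using (_∼[_]_; set; ∼bag⇒↭; map-cong)
open import Data.List.Relation.Binary.Permutation.Propositional.Properties using (↭-length)
open import Data.List.Relation.Unary.All as All using (All; _∷_; [])
import Data.List.Relation.Unary.All.Properties as All
open import Data.List.Relation.Unary.AllPairs using (_∷_; [])
open import Data.List.Relation.Unary.Any using (here; there; index)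
open import Data.List.Relation.Unary.Any.Properties using (lookup-index)
open import Data.List.Relation.Unary.Unique.Propositional using (Unique)
open import Data.List.Relation.Unary.Unique.Propositional.Properties
  using (++⁺; map⁺; allFin⁺; cartesianProductWith⁺)
import Data.List.Relation.Unary.Unique.DecPropositional.Properties as DecUnique
open import Data.Nat using (ℕ; zero; suc; _+_; _*_; _<_; _≤_; _≥_; _≟_; _<?_; s≤s; z≤n)
import Data.Nat.Properties as ℕₚ
open import Data.Nat.Properties
  using (1+n≢n; *-suc; <-irrefl; <⇒≤; <⇒≱; ≮⇒≥; ≤-antisym; ≤-pred; ≤-reflexive)
open import Data.Product using (Σ; ∃; ∃₂; _×_; _,_; proj₁; proj₂; uncurry)
open import Data.Product.Properties using (≡-dec)
open import Data.Sum using (_⊎_; inj₁; inj₂; [_,_])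
import Data.Vec as Vec
open import Function using (_∘_; const; _⇔_; mk⇔; Equivalence; Injective)
open import Relation.Binary.Definitions using (DecidableEquality)
open import Relation.Binary.PropositionalEquality
  using (_≡_; _≢_; refl; sym; trans; cong; cong₂; subst; subst₂; module ≡-Reasoning)
open import Relation.Nullary using (¬_; Dec; yes; no; ¬?; _×-dec_; _⊎-dec_; _→-dec_; contradiction)
open import Relation.Nullary.Decidable using (from-yes; decidable-stable)

TwoColoured : {A : Set} → A → A → A → Set
TwoColoured x y z = ¬ (x ≡ y × y ≡ z) × (x ≡ y ⊎ y ≡ z ⊎ x ≡ z)

twoColoured-cong : ∀ {A : Set} {x y z x′ y′ z′ : A} → x ≡ x′ → y ≡ y′ → z ≡ z′ →
                   TwoColoured x y z → TwoColoured x′ y′ z′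
twoColoured-cong refl refl refl xyz = xyz

twoColoured-rotate : ∀ {A : Set} {x y z : A} → TwoColoured x y z → TwoColoured y z x
twoColoured-rotate (¬xyz , some) = (λ (y≡z , z≡x) → ¬xyz (sym (trans y≡z z≡x) , y≡z))
                                 , [ inj₂ ∘ inj₂ ∘ sym , [ inj₁ , inj₂ ∘ inj₁ ∘ sym ] ] some

twoColoured-≢ : ∀ {A : Set} {x y : A} → TwoColoured x y y → x ≢ y
twoColoured-≢ (¬xyy , _) x≡y = ¬xyy (x≡y , refl)

twoColoured-∈ : ∀ {A : Set} {x y z : A} → TwoColoured x y z → y ≢ z → x ≡ y ⊎ x ≡ z
twoColoured-∈ (_ , some) y≢z = [ inj₁ , [ ⊥-elim ∘ y≢z , inj₂ ] ] some

twoColoured-other : ∀ {A : Set} {x y z : A} → TwoColoured x y z → y ≢ z → x ≢ y → x ≡ z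
twoColoured-other xyz y≢z x≢y = [ ⊥-elim ∘ x≢y , (λ x≡z → x≡z) ] (twoColoured-∈ xyz y≢z)

twoColoured-forced : ∀ {A : Set} {x a b : A} → TwoColoured x a a → TwoColoured x a b → a ≢ b → x ≡ b
twoColoured-forced xaa xab a≢b = twoColoured-other xab a≢b (twoColoured-≢ xaa)

twoColoured-not-rainbow : ∀ {A : Set} {x y z : A} →
                          TwoColoured x y z → x ≢ y → y ≢ z → x ≢ z → ⊥
twoColoured-not-rainbow (_ , some) x≢y y≢z x≢z = [ x≢y , [ y≢z , x≢z ] ] some

module _ {A : Set} (_≟ᴬ_ : DecidableEquality A) where

  twoColoured? : ∀ x y z → Dec (TwoColoured x y z)
  twoColoured? x y z = ¬? (x ≟ᴬ y ×-dec y ≟ᴬ z) ×-dec (x ≟ᴬ y ⊎-dec (y ≟ᴬ z ⊎-dec x ≟ᴬ z))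

  distinct : List A → ℕ
  distinct xs = length (deduplicate _≟ᴬ_ xs)

  distinct₃ : A → A → A → ℕ
  distinct₃ x y z = distinct (x ∷ y ∷ z ∷ [])

  distinct-cong : ∀ {xs ys} → xs ∼[ set ] ys → distinct xs ≡ distinct ys
  distinct-cong xs∼ys = ↭-length (∼bag⇒↭ (unique∧set⇒bag (deduplicate-! _) (deduplicate-! _)
    (mk⇔ (∈-deduplicate⁺ _≟ᴬ_ ∘ Equivalence.to xs∼ys ∘ ∈-deduplicate⁻ _≟ᴬ_ _)
         (∈-deduplicate⁺ _≟ᴬ_ ∘ Equivalence.from xs∼ys ∘ ∈-deduplicate⁻ _≟ᴬ_ _))))
    where open DecUnique _≟ᴬ_ using (deduplicate-!)

  distinct₃-constant : ∀ x → distinct₃ x x x ≡ 1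
  distinct₃-constant x with x ≟ᴬ x
  ... | yes _ = refl
  ... | no x≢x = contradiction refl x≢x

  distinct₃-injective : ∀ {x y z} → x ≢ y → y ≢ z → x ≢ z → distinct₃ x y z ≡ 3
  distinct₃-injective {x} {y} {z} x≢y y≢z x≢z with y ≟ᴬ z
  ... | yes y≡z = contradiction y≡z y≢z
  ... | no _ with x ≟ᴬ y
  ...   | yes x≡y = contradiction x≡y x≢y
  ...   | no _ with x ≟ᴬ z
  ...     | yes x≡z = contradiction x≡z x≢z
  ...     | no _ = refl

  distinct₃-twoColoured : ∀ {x y z} → TwoColoured x y z → distinct₃ x y z ≡ 2
  distinct₃-twoColoured {x} {y} {z} (¬xyz , some) with y ≟ᴬ z
  ... | yes y≡z with x ≟ᴬ y
  ...   | yes x≡y = contradiction (x≡y , y≡z) ¬xyz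
  ...   | no _ = refl
  distinct₃-twoColoured {x} {y} {z} (¬xyz , some) | no y≢z with x ≟ᴬ y
  ...   | yes x≡y with x ≟ᴬ z
  ...     | yes x≡z = contradiction (trans (sym x≡y) x≡z) y≢z
  ...     | no _ = refl
  distinct₃-twoColoured {x} {y} {z} (¬xyz , some) | no y≢z | no x≢y with x ≟ᴬ z
  ...     | yes _ = refl
  ...     | no x≢z = contradiction some [ x≢y , [ y≢z , x≢z ] ]

  twoColoured⇔distinct₃ : ∀ {x y z} →
                          (1 < distinct₃ x y z × distinct₃ x y z < 3) ⇔ TwoColoured x y z
  twoColoured⇔distinct₃ {x} {y} {z} = mk⇔ to (λ xyz → bounds (distinct₃-twoColoured xyz))
    where
    bounds : ∀ {n} → n ≡ 2 → 1 < n × n < 3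
    bounds refl = s≤s (s≤s z≤n) , s≤s (s≤s (s≤s z≤n))
    to : 1 < distinct₃ x y z × distinct₃ x y z < 3 → TwoColoured x y z
    to (1<n , n<3) with x ≟ᴬ y ×-dec y ≟ᴬ z
    ... | yes (refl , refl) = contradiction (subst (1 <_) (distinct₃-constant x) 1<n) (<-irrefl refl)
    ... | no ¬xyz with x ≟ᴬ y ⊎-dec (y ≟ᴬ z ⊎-dec x ≟ᴬ z)
    ...   | yes some = ¬xyz , some
    ...   | no none = contradiction (subst (_< 3) three n<3) (<-irrefl refl)
      where three = distinct₃-injective (none ∘ inj₁) (none ∘ inj₂ ∘ inj₁) (none ∘ inj₂ ∘ inj₂)

∈-triple⁻ : ∀ {n} {a b c x : Fin n} → x ∈ˢ triple a b c → x ≡ a ⊎ x ≡ b ⊎ x ≡ c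
∈-triple⁻ {a = a} {b} {c} x∈ with x∈p∪q⁻ ⁅ a ⁆ _ x∈
... | inj₁ x∈a = inj₁ (x∈⁅y⁆⇒x≡y a x∈a)
... | inj₂ x∈bc with x∈p∪q⁻ ⁅ b ⁆ _ x∈bc
...   | inj₁ x∈b = inj₂ (inj₁ (x∈⁅y⁆⇒x≡y b x∈b))
...   | inj₂ x∈c = inj₂ (inj₂ (x∈⁅y⁆⇒x≡y c x∈c))

∈-triple⁺ : ∀ {n} {a b c x : Fin n} → x ≡ a ⊎ x ≡ b ⊎ x ≡ c → x ∈ˢ triple a b c
∈-triple⁺ (inj₁ refl) = x∈p∪q⁺ (inj₁ (x∈⁅x⁆ _))
∈-triple⁺ (inj₂ (inj₁ refl)) = x∈p∪q⁺ (inj₂ (x∈p∪q⁺ (inj₁ (x∈⁅x⁆ _))))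
∈-triple⁺ (inj₂ (inj₂ refl)) = x∈p∪q⁺ (inj₂ (x∈p∪q⁺ (inj₂ (x∈⁅x⁆ _))))

∈-members : ∀ {n} {p : Subset n} {x} → x ∈ members p ⇔ x ∈ˢ p
∈-members {p = p} = mk⇔ (proj₂ ∘ ∈-filter⁻ (_∈? p) {xs = allFin _})
                        (∈-filter⁺ (_∈? p) (∈-allFin _))

∈-three : ∀ {A : Set} {a b c x : A} → x ∈ a ∷ b ∷ c ∷ [] ⇔ (x ≡ a ⊎ x ≡ b ⊎ x ≡ c)
∈-three = mk⇔ to from
  where
  to : ∀ {A : Set} {a b c x : A} → x ∈ a ∷ b ∷ c ∷ [] → x ≡ a ⊎ x ≡ b ⊎ x ≡ c
  to (here x≡a) = inj₁ x≡a
  to (there (here x≡b)) = inj₂ (inj₁ x≡b)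
  to (there (there (here x≡c))) = inj₂ (inj₂ x≡c)
  from : ∀ {A : Set} {a b c x : A} → x ≡ a ⊎ x ≡ b ⊎ x ≡ c → x ∈ a ∷ b ∷ c ∷ []
  from (inj₁ x≡a) = here x≡a
  from (inj₂ (inj₁ x≡b)) = there (here x≡b)
  from (inj₂ (inj₂ x≡c)) = there (there (here x≡c))

members-triple : ∀ {n} (a b c : Fin n) → members (triple a b c) ∼[ set ] (a ∷ b ∷ c ∷ [])
members-triple a b c = mk⇔ (Equivalence.from ∈-three ∘ ∈-triple⁻ ∘ Equivalence.to ∈-members)
                          (Equivalence.from ∈-members ∘ ∈-triple⁺ ∘ Equivalence.to ∈-three)

numColors-triple : ∀ {n} (f : Fin n → ℕ) (a b c : Fin n) →
                   numColors f (triple a b c) ≡ distinct₃ _≟_ (f a) (f b) (f c)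
numColors-triple f a b c = distinct-cong _≟_ (map-cong (λ _ → refl) (members-triple a b c))

∣⁅x⁆∪p∣≡1+∣p∣ : ∀ {n} {x : Fin n} {p : Subset n} → x ∉ˢ p → ∣ ⁅ x ⁆ ∪ p ∣ ≡ suc ∣ p ∣
∣⁅x⁆∪p∣≡1+∣p∣ {x = zero}  {inside Vec.∷ p}  0∉p = contradiction Vec.here 0∉p
∣⁅x⁆∪p∣≡1+∣p∣ {x = zero}  {outside Vec.∷ p} _   = cong (suc ∘ ∣_∣) (∪-identityˡ p)
∣⁅x⁆∪p∣≡1+∣p∣ {x = suc x} {inside Vec.∷ p}  x∉p = cong suc (∣⁅x⁆∪p∣≡1+∣p∣ (x∉p ∘ Vec.there))
∣⁅x⁆∪p∣≡1+∣p∣ {x = suc x} {outside Vec.∷ p} x∉p = ∣⁅x⁆∪p∣≡1+∣p∣ (x∉p ∘ Vec.there)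

∣triple∣≡3 : ∀ {n} {a b c : Fin n} → a ≢ b → b ≢ c → a ≢ c → ∣ triple a b c ∣ ≡ 3
∣triple∣≡3 {a = a} {b} {c} a≢b b≢c a≢c = trans (∣⁅x⁆∪p∣≡1+∣p∣ a∉bc)
  (cong suc (trans (∣⁅x⁆∪p∣≡1+∣p∣ (x≢y⇒x∉⁅y⁆ b≢c)) (cong suc (∣⁅x⁆∣≡1 c))))
  where
  a∉bc : a ∉ˢ ⁅ b ⁆ ∪ ⁅ c ⁆
  a∉bc a∈ = [ a≢b ∘ x∈⁅y⁆⇒x≡y b , a≢c ∘ x∈⁅y⁆⇒x≡y c ] (x∈p∪q⁻ ⁅ b ⁆ ⁅ c ⁆ a∈)

properOn-triple⇔ : ∀ {n} (f : Fin n → ℕ) {a b c : Fin n} → a ≢ b → b ≢ c → a ≢ c →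
                   ProperOn f (triple a b c) ⇔ TwoColoured (f a) (f b) (f c)
properOn-triple⇔ f {a} {b} {c} a≢b b≢c a≢c
  rewrite numColors-triple f a b c | ∣triple∣≡3 a≢b b≢c a≢c = twoColoured⇔distinct₃ _≟_

module _ {A B : Set} (R : A → B → Set) (R-functional : ∀ {x x′ y} → R x y → R x′ y → x ≡ x′)
         where

  Unique-concatMap⁺ : ∀ {f : A → List B} {xs} → Unique xs → (∀ x → Unique (f x)) →
                      (∀ x → All (R x) (f x)) → Unique (concatMap f xs)
  Unique-concatMap⁺ {xs = []} _ _ _ = []
  Unique-concatMap⁺ {f} {x ∷ xs} (x∉xs ∷ xs!) f! Rf =
    ++⁺ (f! x) (Unique-concatMap⁺ xs! f! Rf) disjoint
    where
    disjoint : ∀ {y} → ¬ (y ∈ f x × y ∈ concatMap f xs)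
    disjoint (y∈fx , y∈rest) with find (∈-concatMap⁻ f {xs = xs} y∈rest)
    ... | x′ , x′∈xs , y∈fx′ =
      All.lookup x∉xs x′∈xs (R-functional (All.lookup (Rf x) y∈fx) (All.lookup (Rf x′) y∈fx′))

module _ {A : Set} where

  lookup-injective : ∀ {xs : List A} → Unique xs → ∀ {i j} → lookup xs i ≡ lookup xs j → i ≡ j
  lookup-injective (_ ∷ _)      {zero}  {zero}  _  = refl
  lookup-injective (x∉xs ∷ _)   {zero}  {suc j} eq = contradiction eq (All.lookup x∉xs (∈-lookup j))
  lookup-injective (x∉xs ∷ _)   {suc i} {zero}  eq = contradiction (sym eq) (All.lookup x∉xs (∈-lookup i))
  lookup-injective (_ ∷ xs!)    {suc i} {suc j} eq = cong suc (lookup-injective xs! eq)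

  lookup-∀⇒∀∈ : ∀ {P : A → Set} {xs} → (∀ i → P (lookup xs i)) → ∀ {x} → x ∈ xs → P x
  lookup-∀⇒∀∈ {P} Pxs x∈xs = subst P (sym (lookup-index x∈xs)) (Pxs (index x∈xs))

module _ {A B : Set} (g : A → B) where

  lookup-map : ∀ xs i → lookup (map g xs) i ≡ g (lookup xs (cast (length-map g xs) i))
  lookup-map (x ∷ xs) zero    = refl
  lookup-map (x ∷ xs) (suc i) = lookup-map xs i

  allBut-map : ∀ {C : Set} {P : C → B → Set} {xs} → Unique xs →
               (∀ x → Σ C λ c → ∀ y → y ≢ x → P c (g y)) →
               ∀ r → Σ C λ c → ∀ i → i ≢ r → P c (lookup (map g xs) i)
  allBut-map {P = P} {xs} xs! allBut r =
    let c , Pc = allBut (lookup xs (cast eq r))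
    in  c , λ i i≢r → subst (P c) (sym (lookup-map xs i))
                                   (Pc _ (i≢r ∘ cast-injective ∘ lookup-injective xs!))
    where
    eq = length-map g xs
    cast-injective : ∀ {i j} → cast eq i ≡ cast eq j → i ≡ j
    cast-injective {i} {j} ci≡cj =
      toℕ-injective (trans (sym (toℕ-cast eq i)) (trans (cong toℕ ci≡cj) (toℕ-cast eq j)))

Tri : Set
Tri = Fin 3 → ℕ

offset : Fin 2 → Fin 3 → Fin 3
offset zero = next3
offset (suc zero) = next3 ∘ next3

offset-moves : ∀ t j → j ≢ offset t j
offset-moves zero zero ()
offset-moves zero (suc zero) ()
offset-moves zero (suc (suc zero)) ()
offset-moves (suc zero) zero ()
offset-moves (suc zero) (suc zero) ()
offset-moves (suc zero) (suc (suc zero)) ()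

suc≢inject₁ : ∀ {n} (q : Fin n) → suc q ≢ inject₁ q
suc≢inject₁ q eq = 1+n≢n (trans (cong toℕ eq) (toℕ-inject₁ q))

next3³ : ∀ j → next3 (next3 (next3 j)) ≡ j
next3³ zero = refl
next3³ (suc zero) = refl
next3³ (suc (suc zero)) = refl

TwoColouredTri : Tri → Set
TwoColouredTri T = TwoColoured (T zero) (T (suc zero)) (T (suc (suc zero)))

LinkedAt : Fin 3 → Fin 2 → Tri → Tri → Set
LinkedAt j t P Q = TwoColoured (Q j) (P j) (P (offset t j))

CappedAt : Fin 2 → ℕ → Tri → Set
CappedAt t c T = TwoColoured c (T (inject₁ t)) (T (suc t))

Linked : Tri → Tri → Set
Linked P Q = ∀ j t → LinkedAt j t P Q

alternate : ∀ {A : Set} → A → A → ℕ → A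
alternate a b zero    = a
alternate a b (suc n) = alternate b a n

alternate-≢ : ∀ {A : Set} {a b : A} → a ≢ b → ∀ n → alternate a b n ≢ alternate b a n
alternate-≢ a≢b zero    = a≢b
alternate-≢ a≢b (suc n) = alternate-≢ (a≢b ∘ sym) n

alternate-even : ∀ {A : Set} (a b : A) n → alternate a b (2 * n) ≡ a
alternate-even a b zero    = refl
alternate-even a b (suc n) = trans (cong (alternate a b) (*-suc 2 n)) (alternate-even a b n)

alternate-zip : ∀ {A B : Set} {R : A → B → Set} {a b a′ b′} → R a a′ → R b b′ →
                ∀ n → R (alternate a b n) (alternate a′ b′ n)
alternate-zip Raa′ Rbb′ zero    = Raa′
alternate-zip {R = R} Raa′ Rbb′ (suc n) = alternate-zip {R = R} Rbb′ Raa′ n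

alternate-all : ∀ {A : Set} {Q : A → Set} {a b} → Q a → Q b → ∀ n → Q (alternate a b n)
alternate-all Qa Qb zero    = Qa
alternate-all {Q = Q} Qa Qb (suc n) = alternate-all {Q = Q} Qb Qa n

alternate-dichotomy : ∀ n → (∀ {A : Set} (a b : A) → alternate a b n ≡ a)
                          ⊎ (∀ {A : Set} (a b : A) → alternate a b n ≡ b)
alternate-dichotomy zero = inj₁ λ _ _ → refl
alternate-dichotomy (suc n) with alternate-dichotomy n
... | inj₁ even = inj₂ λ a b → even b a
... | inj₂ odd  = inj₁ λ a b → odd b a

twoColouredTri-at : ∀ {T} → TwoColouredTri T →
                    ∀ p → TwoColoured (T p) (T (next3 p)) (T (next3 (next3 p)))
twoColouredTri-at T! zero = T!
twoColouredTri-at T! (suc zero) = twoColoured-rotate T!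
twoColouredTri-at T! (suc (suc zero)) = twoColoured-rotate (twoColoured-rotate T!)

Pattern : Fin 3 → ℕ → ℕ → Tri → Set
Pattern p a b T = T p ≡ b × T (next3 p) ≡ a × T (next3 (next3 p)) ≡ a

linked-pattern : ∀ {P Q p a b} → a ≢ b → Linked P Q → TwoColouredTri Q →
                 Pattern p a b P → Pattern p b a Q
linked-pattern {P} {Q} {p} {a} {b} a≢b PQ Q! (Pp , Pp₁ , Pp₂) = Qp , Qp₁ , Qp₂
  where
  p₁ = next3 p
  p₂ = next3 p₁
  P[p₁+2] : P (next3 p₂) ≡ b
  P[p₁+2] = trans (cong P (next3³ p)) Pp
  P[p₂+2] : P (next3 (next3 p₂)) ≡ a
  P[p₂+2] = trans (cong (P ∘ next3) (next3³ p)) Pp₁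
  Qp₁ : Q p₁ ≡ b
  Qp₁ = twoColoured-forced (twoColoured-cong refl Pp₁ Pp₂ (PQ p₁ zero))
                           (twoColoured-cong refl Pp₁ P[p₁+2] (PQ p₁ (suc zero))) a≢b
  Qp₂ : Q p₂ ≡ b
  Qp₂ = twoColoured-forced (twoColoured-cong refl Pp₂ P[p₂+2] (PQ p₂ (suc zero)))
                           (twoColoured-cong refl Pp₂ P[p₁+2] (PQ p₂ zero)) a≢b
  Qp : Q p ≡ a
  Qp with twoColoured-∈ (twoColoured-cong refl Pp Pp₁ (PQ p zero)) (a≢b ∘ sym)
  ... | inj₁ Qp≡b =
    ⊥-elim (proj₁ (twoColouredTri-at {Q} Q! p) (trans Qp≡b (sym Qp₁) , trans Qp₁ (sym Qp₂)))
  ... | inj₂ Qp≡a = Qp≡a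

pattern-chain : ∀ {n} (T : Fin (suc n) → Tri) {p a b} →
                (∀ q → Linked (T (inject₁ q)) (T (suc q))) → (∀ q → TwoColouredTri (T (suc q))) →
                a ≢ b → Pattern p a b (T zero) →
                ∀ r → Pattern p (alternate a b (toℕ r)) (alternate b a (toℕ r)) (T r)
pattern-chain T {p} {a} {b} linked T! a≢b T₀ = <-weakInduction Alternating T₀ step
  where
  Alternating : Fin _ → Set
  Alternating r = Pattern p (alternate a b (toℕ r)) (alternate b a (toℕ r)) (T r)
  step : ∀ q → Alternating (inject₁ q) → Alternating (suc q)
  step q Tq = linked-pattern (alternate-≢ a≢b (toℕ q)) (linked q) (T! q)
    (subst (λ n → Pattern p (alternate a b n) (alternate b a n) (T (inject₁ q))) (toℕ-inject₁ q) Tq)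

patternOf : ∀ {T} → TwoColouredTri T → ∃ λ p → ∃₂ λ a b → a ≢ b × Pattern p a b T
patternOf {T} T!@(¬T012 , _) with T zero ≟ T (suc zero) | T (suc zero) ≟ T (suc (suc zero))
... | yes T₀≡T₁ | _ = suc (suc zero) , T zero , T (suc (suc zero)) ,
  (λ T₀≡T₂ → ¬T012 (T₀≡T₁ , trans (sym T₀≡T₁) T₀≡T₂)) , refl , refl , sym T₀≡T₁
... | no T₀≢T₁ | yes T₁≡T₂ = zero , T (suc zero) , T zero , T₀≢T₁ ∘ sym , refl , refl , sym T₁≡T₂
... | no T₀≢T₁ | no T₁≢T₂ =
  suc zero , T zero , T (suc zero) , T₀≢T₁ , refl , sym (twoColoured-other T! T₁≢T₂ T₀≢T₁) , refl

data Shape (T : Tri) : Set where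
  constant  : ∀ {a} → (∀ j → T j ≡ a) → Shape T
  patterned : ∀ {p a b} → a ≢ b → Pattern p a b T → Shape T
  rainbow   : Injective _≡_ _≡_ T → Shape T

shape : ∀ T → Shape T
shape T with twoColoured? _≟_ (T zero) (T (suc zero)) (T (suc (suc zero)))
... | yes T! = let _ , _ , _ , a≢b , pat = patternOf {T} T! in patterned a≢b pat
... | no ¬T! with T zero ≟ T (suc zero) ×-dec T (suc zero) ≟ T (suc (suc zero))
...   | yes (T₀≡T₁ , T₁≡T₂) =
  constant λ { zero → refl ; (suc zero) → sym T₀≡T₁ ; (suc (suc zero)) → sym (trans T₀≡T₁ T₁≡T₂) }
...   | no ¬T₀₁₂ = rainbow injective
  where
  T₀≢T₁ = λ T₀≡T₁ → ¬T! (¬T₀₁₂ , inj₁ T₀≡T₁)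
  T₁≢T₂ = λ T₁≡T₂ → ¬T! (¬T₀₁₂ , inj₂ (inj₁ T₁≡T₂))
  T₀≢T₂ = λ T₀≡T₂ → ¬T! (¬T₀₁₂ , inj₂ (inj₂ T₀≡T₂))
  injective : Injective _≡_ _≡_ T
  injective {zero} {zero} _ = refl
  injective {zero} {suc zero} eq = ⊥-elim (T₀≢T₁ eq)
  injective {zero} {suc (suc zero)} eq = ⊥-elim (T₀≢T₂ eq)
  injective {suc zero} {zero} eq = ⊥-elim (T₀≢T₁ (sym eq))
  injective {suc zero} {suc zero} _ = refl
  injective {suc zero} {suc (suc zero)} eq = ⊥-elim (T₁≢T₂ eq)
  injective {suc (suc zero)} {zero} eq = ⊥-elim (T₀≢T₂ (sym eq))
  injective {suc (suc zero)} {suc zero} eq = ⊥-elim (T₁≢T₂ (sym eq))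
  injective {suc (suc zero)} {suc (suc zero)} _ = refl

linked-rainbow : ∀ {P Q} → Injective _≡_ _≡_ P → Linked P Q → ∀ j → Q j ≡ P j
linked-rainbow {P} {Q} P-inj PQ j
  with twoColoured-∈ (PQ j zero) (offset-moves zero j ∘ P-inj)
     | twoColoured-∈ (PQ j (suc zero)) (offset-moves (suc zero) j ∘ P-inj)
... | inj₁ Qj≡Pj | _ = Qj≡Pj
... | inj₂ _ | inj₁ Qj≡Pj = Qj≡Pj
... | inj₂ Qj≡Pj₁ | inj₂ Qj≡Pj₂ =
  ⊥-elim (offset-moves zero (next3 j) (P-inj (trans (sym Qj≡Pj₁) Qj≡Pj₂)))

splice : ∀ {A : Set} → ℕ → (ℕ → A) → (ℕ → A) → ℕ → A
splice n f g r with r <? n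
... | yes _ = f r
... | no _  = g r

module _ {A : Set} (n : ℕ) (f g : ℕ → A) where

  splice-< : ∀ {r} → r < n → splice n f g r ≡ f r
  splice-< {r} r<n with r <? n
  ... | yes _  = refl
  ... | no r≮n = contradiction r<n r≮n

  splice-≥ : ∀ {r} → n ≤ r → splice n f g r ≡ g r
  splice-≥ {r} n≤r with r <? n
  ... | yes r<n = contradiction n≤r (<⇒≱ r<n)
  ... | no _    = refl

  splice-at : ∀ {Q : A → Set} r → (r < n → Q (f r)) → (n ≤ r → Q (g r)) → Q (splice n f g r)
  splice-at r before after with r <? n
  ... | yes r<n = before r<n
  ... | no r≮n  = after (≮⇒≥ r≮n)

  splice-step : ∀ {R : A → A → Set} r →
                (suc r < n → R (f r) (f (suc r))) → (suc r ≡ n → R (f r) (g (suc r))) →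
                (n ≤ r → R (g r) (g (suc r))) → R (splice n f g r) (splice n f g (suc r))
  splice-step r before across after with suc r <? n | r <? n
  ... | yes 1+r<n | yes _   = before 1+r<n
  ... | yes 1+r<n | no r≮n  = contradiction (<⇒≤ 1+r<n) r≮n
  ... | no 1+r≮n  | yes r<n = across (≤-antisym r<n (≮⇒≥ 1+r≮n))
  ... | no _      | no r≮n  = after (≮⇒≥ r≮n)

-- A colouring avoiding one edge gives v a fixed colour and colours the layers V_1, …,
-- V_{2k+1} by alternating two triples, the first one on V_1, V_3, ….  Avoiding a top
-- or cross edge: P and swap₁₂ ∘ P throughout.  Avoiding link q j₀ t₀: X and
-- swap₁₂ ∘ X on V_1, …, V_{q+1}, then Y and swap₁₂ ∘ Y; as q may have either parity,
-- both seams are checked.  Avoiding the layer edge V_{i+2}: X and X′ below it, M on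
-- it, Y and Y′ above it, where B and A are the triples on V_{i+1} and V_{i+3}, so that
-- the table depends on the parity of i.  The tables were found by exhaustive search
-- and are verified by evaluating the decision procedures.

twoColouredTri? : ∀ T → Dec (TwoColouredTri T)
twoColouredTri? T = twoColoured? _≟_ _ _ _

linked? : ∀ P Q → Dec (Linked P Q)
linked? P Q = all? λ j → all? λ t → twoColoured? _≟_ _ _ _

Capped : ℕ → Tri → Set
Capped c T = ∀ t → CappedAt t c T

capped? : ∀ c T → Dec (Capped c T)
capped? c T = all? λ t → twoColoured? _≟_ _ _ _

Crossed : ℕ → Tri → Tri → Set
Crossed c P Q = ∀ j → TwoColoured c (P j) (Q j)

crossed? : ∀ c P Q → Dec (Crossed c P Q)
crossed? c P Q = all? λ j → twoColoured? _≟_ c (P j) (Q j)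

Alternation : Tri → Tri → Set
Alternation P P′ = TwoColouredTri P × TwoColouredTri P′ × Linked P P′ × Linked P′ P

alternation? : ∀ P P′ → Dec (Alternation P P′)
alternation? P P′ = twoColouredTri? P ×-dec twoColouredTri? P′ ×-dec linked? P P′ ×-dec linked? P′ P

swap₁₂ : ℕ → ℕ
swap₁₂ 1 = 2
swap₁₂ 2 = 1
swap₁₂ n = n

tri : ℕ → ℕ → ℕ → Tri
tri a b c zero             = a
tri a b c (suc zero)       = b
tri a b c (suc (suc zero)) = c

spike : Fin 3 → Tri
spike j₀ j with j Fin.≟ j₀
... | yes _ = 2
... | no _  = 1

CrossTable : Fin 3 → Set
CrossTable j₀ = Alternation (spike j₀) (swap₁₂ ∘ spike j₀) × Capped 2 (spike j₀) ×
                (∀ j → j ≢ j₀ → TwoColoured 2 (spike j₀ j) (spike j₀ j))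

cross-table : ∀ j₀ → CrossTable j₀
cross-table = from-yes (all? λ j₀ →
  alternation? (spike j₀) (swap₁₂ ∘ spike j₀) ×-dec capped? 2 (spike j₀) ×-dec
  all? λ j → ¬? (j Fin.≟ j₀) →-dec twoColoured? _≟_ 2 (spike j₀ j) (spike j₀ j))

topSpike : Fin 2 → Tri
topSpike zero       = tri 1 2 2
topSpike (suc zero) = tri 1 1 2

TopTable : Fin 2 → Set
TopTable t₀ = Alternation (topSpike t₀) (swap₁₂ ∘ topSpike t₀) ×
              (∀ t → t ≢ t₀ → CappedAt t 3 (topSpike t₀)) × Crossed 3 (topSpike t₀) (topSpike t₀)

top-table : ∀ t₀ → TopTable t₀
top-table = from-yes (all? λ t₀ →
  alternation? (topSpike t₀) (swap₁₂ ∘ topSpike t₀) ×-dec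
  all? (λ t → ¬? (t Fin.≟ t₀) →-dec twoColoured? _≟_ 3 (topSpike t₀ (inject₁ t)) (topSpike t₀ (suc t))) ×-dec
  crossed? 3 (topSpike t₀) (topSpike t₀))

linkSpike : Fin 3 → Fin 2 → Fin 3
linkSpike zero             zero       = suc (suc zero)
linkSpike zero             (suc zero) = suc zero
linkSpike (suc zero)       zero       = zero
linkSpike (suc zero)       (suc zero) = suc (suc zero)
linkSpike (suc (suc zero)) zero       = suc zero
linkSpike (suc (suc zero)) (suc zero) = zero

LinkTable : Fin 3 → Fin 2 → Set
LinkTable j₀ t₀ =
  Alternation X (swap₁₂ ∘ X) × Alternation Y (swap₁₂ ∘ Y) ×
  (∀ j t → (j , t) ≢ (j₀ , t₀) → LinkedAt j t X (swap₁₂ ∘ Y) × LinkedAt j t (swap₁₂ ∘ X) Y) ×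
  Capped 2 Y × Crossed 2 X Y
  where
  X = spike (linkSpike j₀ t₀)
  Y = spike j₀

link-table : ∀ j₀ t₀ → LinkTable j₀ t₀
link-table = from-yes (all? λ j₀ → all? λ t₀ → let X = spike (linkSpike j₀ t₀) ; Y = spike j₀ in
  alternation? X (swap₁₂ ∘ X) ×-dec alternation? Y (swap₁₂ ∘ Y) ×-dec
  all? (λ j → all? λ t → ¬? (≡-dec Fin._≟_ Fin._≟_ (j , t) (j₀ , t₀)) →-dec
    (twoColoured? _≟_ (swap₁₂ (Y j)) (X j) (X (offset t j)) ×-dec
     twoColoured? _≟_ (Y j) (swap₁₂ (X j)) (swap₁₂ (X (offset t j))))) ×-dec
  capped? 2 Y ×-dec crossed? 2 X Y)

LayerTable : ℕ → (X X′ M Y Y′ B A : Tri) → Set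
LayerTable c X X′ M Y Y′ B A = Alternation X X′ × Alternation Y Y′ × Linked B M × Linked M A ×
                               Capped c Y × Crossed c X Y × Capped c M × Crossed c X M

layerTable? : ∀ c X X′ M Y Y′ B A → Dec (LayerTable c X X′ M Y Y′ B A)
layerTable? c X X′ M Y Y′ B A =
  alternation? X X′ ×-dec alternation? Y Y′ ×-dec linked? B M ×-dec linked? M A ×-dec
  capped? c Y ×-dec crossed? c X Y ×-dec capped? c M ×-dec crossed? c X M

even-layer-table :
  LayerTable 1 (tri 1 1 2) (tri 2 2 1) (tri 2 2 2) (tri 3 3 1) (tri 1 1 3) (tri 1 1 2) (tri 3 3 1)
even-layer-table =
  from-yes (layerTable? 1 (tri 1 1 2) (tri 2 2 1) (tri 2 2 2) (tri 3 3 1) (tri 1 1 3) (tri 1 1 2) (tri 3 3 1))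

odd-layer-table :
  LayerTable 2 (tri 1 2 1) (tri 2 1 2) (tri 1 1 1) (tri 2 3 2) (tri 3 2 3) (tri 2 1 2) (tri 3 2 3)
odd-layer-table =
  from-yes (layerTable? 2 (tri 1 2 1) (tri 2 1 2) (tri 1 1 1) (tri 2 3 2) (tri 3 2 3) (tri 2 1 2) (tri 3 2 3))

-- Parametrised by k′ = k - 1: for k = 0 the first and the last layer coincide.
module Hypergraph (k′ : ℕ) where
  k : ℕ
  k = suc k′

  open HDef k public

  data Edge : Set where
    layer : Fin (2 * k) → Edge
    link  : Fin (2 * k) → Fin 3 → Fin 2 → Edge
    top   : Fin 2 → Edge
    cross : Fin 3 → Edge

  corners : Edge → Fin N × Fin N × Fin N
  corners (layer i)    = vx (suc i) zero , vx (suc i) (suc zero) , vx (suc i) (suc (suc zero))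
  corners (link q j t) = vx (suc q) j , vx (inject₁ q) j , vx (inject₁ q) (offset t j)
  corners (top t)      = vv , vx lastL (inject₁ t) , vx lastL (suc t)
  corners (cross j)    = vv , vx zero j , vx lastL j

  edgeSet : Edge → Subset N
  edgeSet e = let a , b , c = corners e in triple a b c

  corners∈ : ∀ e → let a , b , c = corners e in a ∈ˢ edgeSet e × b ∈ˢ edgeSet e × c ∈ˢ edgeSet e
  corners∈ e = ∈-triple⁺ (inj₁ refl) , ∈-triple⁺ (inj₂ (inj₁ refl)) , ∈-triple⁺ (inj₂ (inj₂ refl))

  Distinct₃ : Fin N × Fin N × Fin N → Set
  Distinct₃ (a , b , c) = a ≢ b × b ≢ c × a ≢ c

  vx-injective : ∀ {i i′ j j′} → vx i j ≡ vx i′ j′ → i ≡ i′ × j ≡ j′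
  vx-injective {i} {i′} {j} {j′} = combine-injective i j i′ j′ ∘ suc-injective

  sameLayer : ∀ i {j j′} → j ≢ j′ → vx i j ≢ vx i j′
  sameLayer i j≢j′ = j≢j′ ∘ proj₂ ∘ vx-injective {i} {i}

  otherLayer : ∀ i i′ j j′ → i ≢ i′ → vx i j ≢ vx i′ j′
  otherLayer i i′ j j′ i≢i′ = i≢i′ ∘ proj₁ ∘ vx-injective {i} {i′} {j} {j′}

  corners-distinct : ∀ e → Distinct₃ (corners e)
  corners-distinct (layer i) =
    sameLayer (suc i) (λ ()) , sameLayer (suc i) (λ ()) , sameLayer (suc i) (λ ())
  corners-distinct (link q j t) =
      otherLayer (suc q) (inject₁ q) j j (suc≢inject₁ q)
    , sameLayer (inject₁ q) (offset-moves t j)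
    , otherLayer (suc q) (inject₁ q) j (offset t j) (suc≢inject₁ q)
  corners-distinct (top zero) = (λ ()) , sameLayer lastL (λ ()) , (λ ())
  corners-distinct (top (suc zero)) = (λ ()) , sameLayer lastL (λ ()) , (λ ())
  corners-distinct (cross j) = (λ ()) , otherLayer zero lastL j j (λ ()) , (λ ())

  Fits : ℕ → (Fin m → Tri) → Edge → Set
  Fits c L (layer i)    = TwoColouredTri (L (suc i))
  Fits c L (link q j t) = LinkedAt j t (L (inject₁ q)) (L (suc q))
  Fits c L (top t)      = CappedAt t c (L lastL)
  Fits c L (cross j)    = TwoColoured c (L zero j) (L lastL j)

  layerColours : (Fin N → ℕ) → Fin m → Tri
  layerColours f i j = f (vx i j)

  properOn-edge⇔ : ∀ f e → let a , b , c = corners e in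
                   ProperOn f (edgeSet e) ⇔ TwoColoured (f a) (f b) (f c)
  properOn-edge⇔ f e = let a≢b , b≢c , a≢c = corners-distinct e in properOn-triple⇔ f a≢b b≢c a≢c

  properOn⇔fits : ∀ f e → ProperOn f (edgeSet e) ⇔ Fits (f vv) (layerColours f) e
  properOn⇔fits f e@(layer _)    = properOn-edge⇔ f e
  properOn⇔fits f e@(link _ _ _) = properOn-edge⇔ f e
  properOn⇔fits f e@(top _)      = properOn-edge⇔ f e
  properOn⇔fits f e@(cross _)    = properOn-edge⇔ f e

  data Kind : Set where
    layerᴷ linkᴷ topᴷ crossᴷ : Kind

  kind : Edge → Kind
  kind (layer _)    = layerᴷ
  kind (link _ _ _) = linkᴷ
  kind (top _)      = topᴷ
  kind (cross _)    = crossᴷ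

  linksAt : Fin (2 * k) → List Edge
  linksAt q = concatMap (λ j → map (link q j) (allFin 2)) (allFin 3)

  edgesOfKind : Kind → List Edge
  edgesOfKind layerᴷ = map layer (allFin _)
  edgesOfKind linkᴷ  = concatMap linksAt (allFin _)
  edgesOfKind topᴷ   = map top (allFin 2)
  edgesOfKind crossᴷ = map cross (allFin 3)

  kinds : List Kind
  kinds = layerᴷ ∷ linkᴷ ∷ topᴷ ∷ crossᴷ ∷ []

  allEdges : List Edge
  allEdges = concatMap edgesOfKind kinds

  edges≡ : edges H ≡ map edgeSet allEdges
  edges≡ = sym (begin
    map edgeSet (concatMap edgesOfKind kinds)
      ≡⟨ map-concatMap edgeSet edgesOfKind kinds ⟩
    map edgeSet (edgesOfKind layerᴷ) ++ map edgeSet (edgesOfKind linkᴷ) ++ topEdges ++ crossEdges ++ []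
      ≡⟨ cong₂ _++_ (sym (map-∘ (allFin (2 * k))))
                    (cong₂ _++_ (map-concatMap edgeSet linksAt (allFin _))
                                (cong (topEdges ++_) (++-identityʳ crossEdges))) ⟩
    layerEdges ++ linkEdges ++ topEdges ++ crossEdges ∎)
    where open ≡-Reasoning

  data InRow (q : Fin (2 * k)) : Edge → Set where
    inRow : ∀ {j t} → InRow q (link q j t)

  allEdges-unique : Unique allEdges
  allEdges-unique =
    Unique-concatMap⁺ (λ κ e → kind e ≡ κ) (λ { refl refl → refl }) kinds-unique block-unique block-kind
    where
    kinds-unique : Unique kinds
    kinds-unique = ((λ ()) ∷ (λ ()) ∷ (λ ()) ∷ []) ∷ ((λ ()) ∷ (λ ()) ∷ []) ∷ ((λ ()) ∷ []) ∷ [] ∷ []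
    block-unique : ∀ κ → Unique (edgesOfKind κ)
    block-unique layerᴷ = map⁺ {f = layer} (λ { refl → refl }) (allFin⁺ _)
    block-unique linkᴷ  = Unique-concatMap⁺ InRow (λ { inRow inRow → refl }) (allFin⁺ _)
      (λ q → cartesianProductWith⁺ (link q) (λ { refl → refl , refl }) (allFin⁺ 3) (allFin⁺ 2))
      (λ q → inRow ∷ inRow ∷ inRow ∷ inRow ∷ inRow ∷ inRow ∷ [])
    block-unique topᴷ   = map⁺ {f = top} (λ { refl → refl }) (allFin⁺ 2)
    block-unique crossᴷ = map⁺ {f = cross} (λ { refl → refl }) (allFin⁺ 3)
    block-kind : ∀ κ → All (λ e → kind e ≡ κ) (edgesOfKind κ)
    block-kind layerᴷ = All.map⁺ {f = layer} (All.universal (λ _ → refl) _)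
    block-kind linkᴷ  = All.concat⁺ (All.map⁺ {f = linksAt}
      (All.universal (λ _ → refl ∷ refl ∷ refl ∷ refl ∷ refl ∷ refl ∷ []) (allFin (2 * k))))
    block-kind topᴷ   = All.map⁺ {f = top} (All.universal (λ _ → refl) _)
    block-kind crossᴷ = All.map⁺ {f = cross} (All.universal (λ _ → refl) _)

  ∈-allEdges : ∀ e → e ∈ allEdges
  ∈-allEdges e = ∈-concatMap⁺ edgesOfKind (lose (∈-kinds (kind e)) (∈-block e))
    where
    ∈-kinds : ∀ κ → κ ∈ kinds
    ∈-kinds layerᴷ = here refl
    ∈-kinds linkᴷ  = there (here refl)
    ∈-kinds topᴷ   = there (there (here refl))
    ∈-kinds crossᴷ = there (there (there (here refl)))
    ∈-block : ∀ e → e ∈ edgesOfKind (kind e)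
    ∈-block (layer i)    = ∈-map⁺ layer (∈-allFin i)
    ∈-block (link q j t) =
      ∈-concatMap⁺ linksAt (lose (∈-allFin q)
        (∈-concatMap⁺ (λ j → map (link q j) (allFin 2)) (lose (∈-allFin j) (∈-map⁺ (link q j) (∈-allFin t)))))
    ∈-block (top t)      = ∈-map⁺ top (∈-allFin t)
    ∈-block (cross j)    = ∈-map⁺ cross (∈-allFin j)

module Uncolourability (k′ : ℕ) where
  open Hypergraph k′

  at-last : ∀ {A : Set} (a b : A) → alternate a b (toℕ lastL) ≡ a
  at-last a b = trans (cong (alternate a b) (toℕ-fromℕ (2 * k))) (alternate-even a b k)

  -- 2k − 1, written as the normal form of 2 * k = suc (k′ + 1 * k), so that suc preLast is lastL.
  preLast : Fin (2 * k)
  preLast = fromℕ (k′ + 1 * k)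

  at-preLast : ∀ {A : Set} (a b : A) → alternate a b (toℕ preLast) ≡ b
  at-preLast a b = trans (cong (alternate a b) (toℕ-fromℕ (k′ + 1 * k))) (alternate-even b a k)

  module _ {c : ℕ} {L : Fin m → Tri} (fits : ∀ e → Fits c L e) where

    linked : ∀ q → Linked (L (inject₁ q)) (L (suc q))
    linked q j t = fits (link q j t)

    layers-twoColoured : ∀ i → TwoColouredTri (L (suc i))
    layers-twoColoured i = fits (layer i)

    top-clash : ∀ {p a b} → a ≢ b → Pattern p a b (L lastL) → c ≢ a → c ≢ b → ⊥
    top-clash {zero} a≢b (Lp , Lp₁ , _) c≢a c≢b =
      twoColoured-not-rainbow (twoColoured-cong refl Lp Lp₁ (fits (top zero))) c≢b (a≢b ∘ sym) c≢a
    top-clash {suc zero} a≢b (Lp , _ , Lp₂) c≢a c≢b =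
      twoColoured-not-rainbow (twoColoured-cong refl Lp₂ Lp (fits (top zero))) c≢a a≢b c≢b
    top-clash {suc (suc zero)} a≢b (Lp , _ , Lp₂) c≢a c≢b =
      twoColoured-not-rainbow (twoColoured-cong refl Lp₂ Lp (fits (top (suc zero)))) c≢a a≢b c≢b

    rainbow-clash : Injective _≡_ _≡_ (L zero) → ⊥
    rainbow-clash L₀-inj =
      twoColoured-not-rainbow (twoColoured-cong (L₁≡L₀ _) (L₁≡L₀ _) (L₁≡L₀ _) (layers-twoColoured zero))
        ((λ ()) ∘ L₀-inj) ((λ ()) ∘ L₀-inj) ((λ ()) ∘ L₀-inj)
      where L₁≡L₀ = linked-rainbow L₀-inj (linked zero)

    pattern-clash : ∀ {p a b} → a ≢ b → Pattern p a b (L zero) → ⊥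
    pattern-clash {p} {a} {b} a≢b L₀ = top-clash a≢b Lₗ c≢a c≢b
      where
      Lₗ : Pattern p a b (L lastL)
      Lₗ = let Lp , Lp₁ , Lp₂ = pattern-chain L linked layers-twoColoured a≢b L₀ lastL
           in  trans Lp (at-last b a) , trans Lp₁ (at-last a b) , trans Lp₂ (at-last a b)
      c≢b : c ≢ b
      c≢b = twoColoured-≢ (twoColoured-cong refl (proj₁ L₀) (proj₁ Lₗ) (fits (cross p)))
      c≢a : c ≢ a
      c≢a = twoColoured-≢
              (twoColoured-cong refl (proj₁ (proj₂ L₀)) (proj₁ (proj₂ Lₗ)) (fits (cross (next3 p))))

    constant-clash : ∀ {a} → (∀ j → L zero j ≡ a) → ⊥
    constant-clash {a} L₀≡a with patternOf {L (suc zero)} (layers-twoColoured zero)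
    ... | p , a′ , b′ , a′≢b′ , L₁ = clash (c ≟ a)
      where
      L₁≢a : ∀ j → L (suc zero) j ≢ a
      L₁≢a j = twoColoured-≢ (twoColoured-cong refl (L₀≡a j) (L₀≡a (next3 j)) (linked zero j zero))
      b′≢a : b′ ≢ a
      b′≢a = L₁≢a p ∘ trans (proj₁ L₁)
      a′≢a : a′ ≢ a
      a′≢a = L₁≢a (next3 p) ∘ trans (proj₁ (proj₂ L₁))
      Lₗ : Pattern p b′ a′ (L lastL)
      Lₗ = let Lp , Lp₁ , Lp₂ = pattern-chain (L ∘ suc) (linked ∘ suc) (layers-twoColoured ∘ suc)
                                              a′≢b′ L₁ preLast
           in  trans Lp (at-preLast b′ a′) , trans Lp₁ (at-preLast a′ b′) , trans Lp₂ (at-preLast a′ b′)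
      clash : Dec (c ≡ a) → ⊥
      clash (yes refl) = top-clash (a′≢b′ ∘ sym) Lₗ (b′≢a ∘ sym) (a′≢a ∘ sym)
      clash (no c≢a)   = a′≢b′ (trans (sym c≡a′) c≡b′)
        where
        c≡a′ : c ≡ a′
        c≡a′ = twoColoured-other (twoColoured-cong refl (L₀≡a p) (proj₁ Lₗ) (fits (cross p)))
                                 (a′≢a ∘ sym) c≢a
        c≡b′ : c ≡ b′
        c≡b′ = twoColoured-other
                 (twoColoured-cong refl (L₀≡a (next3 p)) (proj₁ (proj₂ Lₗ)) (fits (cross (next3 p))))
                 (b′≢a ∘ sym) c≢a

    ¬fits-everywhere : ⊥
    ¬fits-everywhere with shape (L zero)
    ... | constant L₀≡a       = constant-clash L₀≡a
    ... | patterned a≢b L₀    = pattern-clash a≢b L₀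
    ... | rainbow L₀-injective = rainbow-clash L₀-injective

  uncolourable : ¬ Colorable H
  uncolourable (f , proper) = ¬fits-everywhere λ e → Equivalence.to (properOn⇔fits f e) (proper-on e)
    where
    proper-on : ∀ e → ProperOn f (edgeSet e)
    proper-on e = lookup-∀⇒∀∈ {P = ProperOn f} (subst (λ es → ∀ i → ProperOn f (lookup es i)) edges≡ proper)
                              (∈-map⁺ edgeSet (∈-allEdges e))

module AvoidingColourings (k′ : ℕ) where
  open Hypergraph k′

  colouring : ℕ → (Fin m → Tri) → Fin N → ℕ
  colouring c L zero    = c
  colouring c L (suc x) = uncurry L (remQuot 3 x)

  layerColours-colouring : ∀ c L i j → layerColours (colouring c L) i j ≡ L i j
  layerColours-colouring c L i j = cong (uncurry L) (remQuot-combine i j)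

  fits-cong : ∀ {c L L′} → (∀ i j → L i j ≡ L′ i j) → ∀ e → Fits c L e → Fits c L′ e
  fits-cong L≗L′ (layer i)    = twoColoured-cong (L≗L′ _ _) (L≗L′ _ _) (L≗L′ _ _)
  fits-cong L≗L′ (link q j t) = twoColoured-cong (L≗L′ _ _) (L≗L′ _ _) (L≗L′ _ _)
  fits-cong L≗L′ (top t)      = twoColoured-cong refl (L≗L′ _ _) (L≗L′ _ _)
  fits-cong L≗L′ (cross j)    = twoColoured-cong refl (L≗L′ _ _) (L≗L′ _ _)

  fits⇒properOn-colouring : ∀ {c L} e → Fits c L e → ProperOn (colouring c L) (edgeSet e)
  fits⇒properOn-colouring {c} {L} e =
    Equivalence.from (properOn⇔fits (colouring c L) e)
    ∘ fits-cong (λ i j → sym (layerColours-colouring c L i j)) e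

  Fitsℕ : ℕ → (ℕ → Tri) → Edge → Set
  Fitsℕ c D (layer i)    = TwoColouredTri (D (suc (toℕ i)))
  Fitsℕ c D (link q j t) = LinkedAt j t (D (toℕ q)) (D (suc (toℕ q)))
  Fitsℕ c D (top t)      = CappedAt t c (D (2 * k))
  Fitsℕ c D (cross j)    = TwoColoured c (D 0 j) (D (2 * k) j)

  fitsℕ⇒fits : ∀ {c D} e → Fitsℕ c D e → Fits c (D ∘ toℕ) e
  fitsℕ⇒fits         (layer i)    = λ fits → fits
  fitsℕ⇒fits {D = D} (link q j t) =
    subst (λ n → LinkedAt j t (D n) (D (suc (toℕ q)))) (sym (toℕ-inject₁ q))
  fitsℕ⇒fits {c} {D} (top t)      = subst (CappedAt t c ∘ D) (sym (toℕ-fromℕ (2 * k)))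
  fitsℕ⇒fits {c} {D} (cross j)    =
    subst (λ n → TwoColoured c (D 0 j) (D n j)) (sym (toℕ-fromℕ (2 * k)))

  AvoidingColouring : Edge → Set
  AvoidingColouring e₀ = Σ (Fin N → ℕ) λ f → ∀ e → e ≢ e₀ → ProperOn f (edgeSet e)

  avoiding-colouring : ∀ {e₀} c D → (∀ e → e ≢ e₀ → Fitsℕ c D e) → AvoidingColouring e₀
  avoiding-colouring c D fits =
    colouring c (D ∘ toℕ) , λ e e≢e₀ → fits⇒properOn-colouring e (fitsℕ⇒fits e (fits e e≢e₀))

  alternating-colouring : ∀ {e₀ c P P′} → Alternation P P′ → (∀ t → top t ≢ e₀ → CappedAt t c P) →
                          (∀ j → cross j ≢ e₀ → TwoColoured c (P j) (P j)) → AvoidingColouring e₀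
  alternating-colouring {e₀} {c} {P} {P′} (P! , P′! , PP′ , P′P) capped crossed =
    avoiding-colouring c (alternate P P′) fits
    where
    fits : ∀ e → e ≢ e₀ → Fitsℕ c (alternate P P′) e
    fits (layer i)    _     = alternate-all {Q = TwoColouredTri} P! P′! (suc (toℕ i))
    fits (link q j t) _     = alternate-zip {R = LinkedAt j t} (PP′ j t) (P′P j t) (toℕ q)
    fits (top t)      e≢e₀ = subst (CappedAt t c) (sym (alternate-even P P′ k)) (capped t e≢e₀)
    fits (cross j)    e≢e₀ =
      subst (λ T → TwoColoured c (P j) (T j)) (sym (alternate-even P P′ k)) (crossed j e≢e₀)

  avoid-cross : ∀ j₀ → AvoidingColouring (cross j₀)
  avoid-cross j₀ = let alt , capped , crossed = cross-table j₀
                   in  alternating-colouring alt (λ t _ → capped t) (λ j j≢ → crossed j (j≢ ∘ cong cross))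

  avoid-top : ∀ t₀ → AvoidingColouring (top t₀)
  avoid-top t₀ = let alt , capped , crossed = top-table t₀
                 in  alternating-colouring alt (λ t t≢ → capped t (t≢ ∘ cong top)) (λ j _ → crossed j)

  avoid-link : ∀ q₀ j₀ t₀ → AvoidingColouring (link q₀ j₀ t₀)
  avoid-link q₀ j₀ t₀ = avoiding-colouring 2 D (fits (link-table j₀ t₀))
    where
    X = spike (linkSpike j₀ t₀)
    Y = spike j₀
    n₀ = suc (toℕ q₀)
    Xs Ys D : ℕ → Tri
    Xs = alternate X (swap₁₂ ∘ X)
    Ys = alternate Y (swap₁₂ ∘ Y)
    D = splice n₀ Xs Ys
    D-last : D (2 * k) ≡ Y
    D-last = trans (splice-≥ n₀ Xs Ys (toℕ<n q₀)) (alternate-even Y (swap₁₂ ∘ Y) k)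
    fits : LinkTable j₀ t₀ → ∀ e → e ≢ link q₀ j₀ t₀ → Fitsℕ 2 D e
    fits ((X! , X′! , _) , (Y! , Y′! , _) , _) (layer i) _ =
      splice-at n₀ Xs Ys {Q = TwoColouredTri} (suc (toℕ i))
      (λ _ → alternate-all {Q = TwoColouredTri} X! X′! (suc (toℕ i)))
      (λ _ → alternate-all {Q = TwoColouredTri} Y! Y′! (suc (toℕ i)))
    fits ((_ , _ , XX′ , X′X) , (_ , _ , YY′ , Y′Y) , across , _) (link q j t) e≢e₀ =
      splice-step n₀ Xs Ys {R = LinkedAt j t} (toℕ q)
        (λ _ → alternate-zip {R = LinkedAt j t} (XX′ j t) (X′X j t) (toℕ q))
        (λ 1+q≡1+q₀ → let X→Y′ , X′→Y = across j t λ { refl → e≢e₀ (cong (λ q → link q j t)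
                                                           (toℕ-injective (ℕₚ.suc-injective 1+q≡1+q₀))) }
                       in  alternate-zip {R = LinkedAt j t} X→Y′ X′→Y (toℕ q))
        (λ _ → alternate-zip {R = LinkedAt j t} (YY′ j t) (Y′Y j t) (toℕ q))
    fits (_ , _ , _ , capped , _) (top t) _ = subst (CappedAt t 2) (sym D-last) (capped t)
    fits (_ , _ , _ , _ , crossed) (cross j) _ =
      subst (λ T → TwoColoured 2 (X j) (T j)) (sym D-last) (crossed j)

  avoid-layer-with : ∀ i₀ {c X X′ M Y Y′} →
                     LayerTable c X X′ M Y Y′ (alternate X X′ (toℕ i₀)) (alternate Y Y′ (toℕ i₀)) →
                     AvoidingColouring (layer i₀)
  avoid-layer-with i₀ {c} {X} {X′} {M} {Y} {Y′}
    ((X! , X′! , XX′ , X′X) , (Y! , Y′! , YY′ , Y′Y) , into-M , out-of-M ,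
     cappedY , crossedY , cappedM , crossedM) =
    avoiding-colouring c D fits
    where
    n₀ = suc (toℕ i₀)
    Xs Ys Rest D : ℕ → Tri
    Xs = alternate X X′
    Ys = alternate Y Y′
    Rest = splice (suc n₀) (const M) Ys
    D = splice n₀ Xs Rest
    D-last : ∀ {Q : Tri → Set} → Q M → Q Y → Q (D (2 * k))
    D-last {Q} QM QY = subst Q (sym (splice-≥ n₀ Xs Rest (toℕ<n i₀)))
      (splice-at (suc n₀) (const M) Ys {Q = Q} (2 * k)
        (λ _ → QM) (λ _ → subst Q (sym (alternate-even Y Y′ k)) QY))
    fits : ∀ e → e ≢ layer i₀ → Fitsℕ c D e
    fits (layer i) e≢e₀ = splice-at n₀ Xs Rest {Q = TwoColouredTri} (suc (toℕ i))
      (λ _ → alternate-all {Q = TwoColouredTri} X! X′! (suc (toℕ i)))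
      (λ n₀≤r → splice-at (suc n₀) (const M) Ys {Q = TwoColouredTri} (suc (toℕ i))
        (λ r<1+n₀ → contradiction
          (cong layer (toℕ-injective (ℕₚ.suc-injective (≤-antisym (≤-pred r<1+n₀) n₀≤r)))) e≢e₀)
        (λ _ → alternate-all {Q = TwoColouredTri} Y! Y′! (suc (toℕ i))))
    fits (link q j t) _ = splice-step n₀ Xs Rest {R = LinkedAt j t} (toℕ q)
      (λ _ → alternate-zip {R = LinkedAt j t} (XX′ j t) (X′X j t) (toℕ q))
      (λ 1+r≡n₀ → subst (LinkedAt j t (Xs (toℕ q)))
                          (sym (splice-< (suc n₀) (const M) Ys (s≤s (≤-reflexive 1+r≡n₀))))
                          (subst (λ r → LinkedAt j t (Xs r) M) (sym (ℕₚ.suc-injective 1+r≡n₀)) (into-M j t)))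
      (λ n₀≤r → splice-step (suc n₀) (const M) Ys {R = LinkedAt j t} (toℕ q)
        (λ 1+r<1+n₀ → contradiction n₀≤r (<⇒≱ (≤-pred 1+r<1+n₀)))
        (λ 1+r≡1+n₀ → subst (λ r → LinkedAt j t M (Ys (suc r))) (sym (ℕₚ.suc-injective 1+r≡1+n₀))
                                (out-of-M j t))
        (λ _ → alternate-zip {R = LinkedAt j t} (YY′ j t) (Y′Y j t) (toℕ q)))
    fits (top t) _ = D-last {Q = CappedAt t c} (cappedM t) (cappedY t)
    fits (cross j) _ = subst (λ T → TwoColoured c (T j) (D (2 * k) j)) (sym (splice-< n₀ Xs Rest (s≤s z≤n)))
      (D-last {Q = λ T → TwoColoured c (X j) (T j)} (crossedM j) (crossedY j))

  avoid-layer : ∀ i₀ → AvoidingColouring (layer i₀)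
  avoid-layer i₀ with alternate-dichotomy (toℕ i₀)
  ... | inj₁ even =
    avoid-layer-with i₀ (subst₂ (LayerTable _ _ _ _ _ _) (sym (even _ _)) (sym (even _ _)) even-layer-table)
  ... | inj₂ odd  =
    avoid-layer-with i₀ (subst₂ (LayerTable _ _ _ _ _ _) (sym (odd _ _)) (sym (odd _ _)) odd-layer-table)

module Minimality (k′ : ℕ) where
  open Hypergraph k′
  open AvoidingColourings k′

  avoid : ∀ e₀ → AvoidingColouring e₀
  avoid (layer i)    = avoid-layer i
  avoid (link q j t) = avoid-link q j t
  avoid (top t)      = avoid-top t
  avoid (cross j)    = avoid-cross j

  avoiding : ∀ r → Σ (Fin N → ℕ) λ f → ∀ i → i ≢ r → ProperOn f (edge H i)
  avoiding = subst (λ es → ∀ r → Σ (Fin N → ℕ) λ f → ∀ i → i ≢ r → ProperOn f (lookup es i))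
                   (sym edges≡) (allBut-map edgeSet {P = ProperOn} allEdges-unique avoid)

  vertex-covered : ∀ x → ∃ λ e → x ∈ˢ edgeSet e
  vertex-covered zero    = cross zero , proj₁ (corners∈ (cross zero))
  vertex-covered (suc x) = cover (remQuot 3 x) (combine-remQuot {m} 3 x)
    where
    cover : ∀ (ij : Fin m × Fin 3) → uncurry combine ij ≡ x → ∃ λ e → suc x ∈ˢ edgeSet e
    cover (zero  , j)              refl = cross j , proj₁ (proj₂ (corners∈ (cross j)))
    cover (suc i , zero)           refl = layer i , proj₁ (corners∈ (layer i))
    cover (suc i , suc zero)       refl = layer i , proj₁ (proj₂ (corners∈ (layer i)))
    cover (suc i , suc (suc zero)) refl = layer i , proj₂ (proj₂ (corners∈ (layer i)))

  in-some-edge : ∀ x → ∃ λ i → x ∈ˢ edge H i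
  in-some-edge x = subst (λ es → ∃ λ i → x ∈ˢ lookup es i) (sym edges≡)
                         (index e∈ , subst (x ∈ˢ_) (lookup-index e∈) x∈e)
    where
    e = proj₁ (vertex-covered x)
    x∈e = proj₂ (vertex-covered x)
    e∈ : edgeSet e ∈ map edgeSet allEdges
    e∈ = ∈-map⁺ edgeSet (∈-allEdges e)

  colourable-without : ∀ (S : SubHypergraph H) r → r ∉ˢ E′ S → SubColorable S
  colourable-without S r r∉E′ = proj₁ (avoiding r) , proper
    where
    proper : ∀ i → i ∈ˢ E′ S → ProperOn (proj₁ (avoiding r)) (edge H i)
    proper i i∈E′ = proj₂ (avoiding r) i (λ i≡r → r∉E′ (subst (_∈ˢ E′ S) i≡r i∈E′))

  all-edges⇒whole : ∀ (S : SubHypergraph H) → (∀ i → i ∈ˢ E′ S) → V′ S ≡ ⊤ × E′ S ≡ ⊤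
  all-edges⇒whole S ∈E′ = ⊆-antisym (⊆-max _) ∈V′ , ⊆-antisym (⊆-max _) (λ {i} _ → ∈E′ i)
    where
    ∈V′ : ∀ {x} → x ∈ˢ ⊤ → x ∈ˢ V′ S
    ∈V′ {x} _ = let i , x∈i = in-some-edge x in edgesIn S i (∈E′ i) x∈i

  minimal : ∀ S → IsProper S → SubColorable S
  minimal S S-proper with any? (λ r → ¬? (r ∈? E′ S))
  ... | yes (r , r∉E′) = colourable-without S r r∉E′
  ... | no none-out =
    contradiction (all-edges⇒whole S λ i → decidable-stable (i ∈? E′ S) (λ i∉E′ → none-out (i , i∉E′)))
                  S-proper

lemma4p4 : (k : ℕ) → k ≥ 1 → MinimalUncolorable (Hlemma k)
lemma4p4 zero    ()
lemma4p4 (suc k′) _ = Uncolourability.uncolourable k′ , Minimality.minimal k′
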